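{- Let $\omega\in S_n$. The poset $M_\omega$ has a parallelogram-pattern if and only if $\omega$ contains the pattern $3412$ or the pattern $3421$.
   Context: Permutations are in one-line notation. ${\rm Inv}(\omega)=\{(i,j): 1\le i<j\le n,\ \omega(i)>\omega(j)\}$; $c_i(\omega)=\#\{j>i: \omega(i)>\omega(j)\}$; for $i<j$, $c_{i,j}(\omega)=\#\{k: i<k<j,\ \omega(i)>\omega(k)\}$; $[m]=\{1,\dots,m\}$. For $c_i(\omega)>0$ and $x\in[c_i(\omega)]$, $m_{i,x}(\omega)\in\mathbb{N}^n$ has $j$-th coordinate: $0$ if $(i,j)\in{\rm Inv}(\omega)$; $0$ if $j<i$; $x$ if $j=i$; $\max\{0,x-c_{i,j}(\omega)\}$ if $j>i$ and $(i,j)\notin{\rm Inv}(\omega)$. $M_\omega$ is the set of all $m_{i,x}(\omega)$, ordered componentwise. For $1\le i<j\le n$, $b<a$ in $[c_i(\omega)]$, $c<d$ in $[c_j(\omega)]$ with $a+c=b+d$, the set $\{m_{i,a}(\omega),m_{i,b}(\omega),m_{j,c}(\omega),m_{j,d}(\omega)\}$ is a parallelogram-pattern poset if $m_{i,a}(\omega)>m_{j,d}(\omega)$, $m_{i,b}(\omega)>m_{j,c}(\omega)$, and $m_{i,b}(\omega)$, $m_{j,d}(\omega)$ are incomparable; $M_\omega$ has a parallelogram-pattern if it contains such a set. $\omega$ contains the pattern $\pi\in S_4$ if there exist $i_1<i_2<i_3<i_4$ with $\omega(i_1)\omega(i_2)\omega(i_3)\omega(i_4)$ order-isomorphic to $\pi(1)\pi(2)\pi(3)\pi(4)$.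 -}

module Defs where

open import Data.Nat using (ℕ; suc; _∸_; _≤_; _<_; _≤?_; _+_)
open import Data.Fin using (Fin; toℕ; _<?_)
import Data.Fin as F
open import Data.Fin.Permutation using (Permutation′; _⟨$⟩ʳ_)
open import Data.List using (List; length; filter; allFin)
open import Data.Product using (Σ; _×_; ∃-syntax)
open import Data.Empty using (⊥)
open import Relation.Nullary using (¬_; yes; no)
open import Relation.Nullary.Decidable using (_×-dec_)
open import Relation.Binary.PropositionalEquality using (_≡_)

-- Positions are Fin n (0-based internally, i.e. position p stands for p+1);
-- only relative order of positions and of values matters.

Inv : ∀ {n} → Permutation′ n → Fin n → Fin n → Set
Inv ω i j = (i F.< j) × ((ω ⟨$⟩ʳ j) F.< (ω ⟨$⟩ʳ i))

cₚ : ∀ {n} → Permutation′ n → Fin n → ℕ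
cₚ {n} ω i = length (filter (λ j → (i <? j) ×-dec ((ω ⟨$⟩ʳ j) <? (ω ⟨$⟩ʳ i))) (allFin n))

cₚ₂ : ∀ {n} → Permutation′ n → Fin n → Fin n → ℕ
cₚ₂ {n} ω i j =
  length (filter (λ k → (i <? k) ×-dec ((k <? j) ×-dec ((ω ⟨$⟩ʳ k) <? (ω ⟨$⟩ʳ i)))) (allFin n))

mvec : ∀ {n} → Permutation′ n → Fin n → ℕ → Fin n → ℕ
mvec ω i x j with j <? i
... | yes _ = 0
... | no _ with i <? j
...   | no _ = x
...   | yes _ with (ω ⟨$⟩ʳ j) <? (ω ⟨$⟩ʳ i)
...     | yes _ = 0
...     | no _ = x ∸ cₚ₂ ω i j                    -- max{0, x - c_{i,j}(ω)}

_≼_ : ∀ {n} → (Fin n → ℕ) → (Fin n → ℕ) → Set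
u ≼ v = ∀ j → u j ≤ v j

_≻_ : ∀ {n} → (Fin n → ℕ) → (Fin n → ℕ) → Set
u ≻ v = (v ≼ u) × ¬ (∀ j → u j ≡ v j)

Incomparable : ∀ {n} → (Fin n → ℕ) → (Fin n → ℕ) → Set
Incomparable u v = ¬ (u ≼ v) × ¬ (v ≼ u)

InRange : ℕ → ℕ → Set
InRange x m = (1 ≤ x) × (x ≤ m)

HasParallelogramPattern : ∀ {n} → Permutation′ n → Set
HasParallelogramPattern ω =
  ∃[ i ] ∃[ j ] ∃[ a ] ∃[ b ] ∃[ c ] ∃[ d ]
    ( (i F.< j)
    × InRange a (cₚ ω i) × InRange b (cₚ ω i) × (b < a)
    × InRange c (cₚ ω j) × InRange d (cₚ ω j) × (c < d)
    × (a + c ≡ b + d)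
    × (mvec ω i a ≻ mvec ω j d)
    × (mvec ω i b ≻ mvec ω j c)
    × Incomparable (mvec ω i b) (mvec ω j d) )

-- ω contains π ∈ S₄ (π given in one-line notation by its values,
-- taken 0-based: p₁ p₂ p₃ p₄ a permutation of 0,1,2,3).
-- Order-isomorphism: ω(i_s) < ω(i_t) iff p_s < p_t, for all s, t.
ContainsPattern : ∀ {n} → Permutation′ n → (Fin 4 → Fin 4) → Set
ContainsPattern {n} ω π =
  Σ (Fin 4 → Fin n) λ ι →
    (∀ s t → s F.< t → ι s F.< ι t)
    × (∀ s t → ((ω ⟨$⟩ʳ ι s) F.< (ω ⟨$⟩ʳ ι t) → π s F.< π t)
             × (π s F.< π t → (ω ⟨$⟩ʳ ι s) F.< (ω ⟨$⟩ʳ ι t)))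

p3412 : Fin 4 → Fin 4
p3412 F.zero = F.suc (F.suc F.zero)
p3412 (F.suc F.zero) = F.suc (F.suc (F.suc F.zero))
p3412 (F.suc (F.suc F.zero)) = F.zero
p3412 (F.suc (F.suc (F.suc F.zero))) = F.suc F.zero

p3421 : Fin 4 → Fin 4
p3421 F.zero = F.suc (F.suc F.zero)
p3421 (F.suc F.zero) = F.suc (F.suc (F.suc F.zero))
p3421 (F.suc (F.suc F.zero)) = F.suc F.zero
p3421 (F.suc (F.suc (F.suc F.zero))) = F.zero

-- For i < j and y ≥ 1, the coordinate j shows that m_{j,y}(ω) ≤ m_{i,x}(ω) forces
-- ω(i) < ω(j) and y + c_{i,j}(ω) ≤ x, and conversely these suffice, since beyond j
-- c_{i,t} ≤ c_{i,j} + c_{j,t}.  When ω(i) < ω(j), the inversions of i split into those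
-- before j, counted by c_{i,j}, and the positions t > j with ω(t) < ω(i).  A parallelogram
-- m_{i,a} > m_{j,d} with d ≥ 2 therefore yields two such positions k < l, that is an
-- occurrence of 3412 or 3421 at i j k l.  Conversely such an occurrence gives the
-- parallelogram a = c_{i,j} + 2, b = c_{i,j} + 1, c = 1, d = 2.
module Submission where

open import Defs
open import Data.Nat using (ℕ; suc; _+_; _∸_; _≤_; z≤n; s≤s; z<s; s<s)
import Data.Nat.Properties as ℕₚ
open import Data.Fin using (Fin; _<_; _<?_)
open import Data.Fin.Patterns using (0F; 1F; 2F; 3F)
import Data.Fin.Properties as Finₚ
open import Data.Fin.Permutation using (Permutation′; _⟨$⟩ʳ_)
open import Data.List using (List; []; _∷_; length; filter; allFin; lookup)
open import Data.List.Membership.Propositional using (_∈_)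
open import Data.List.Membership.Propositional.Properties using (∈-allFin; ∈-filter⁺; ∈-filter⁻)
open import Data.List.Relation.Unary.Any using (here; there)
open import Data.List.Relation.Unary.All using (_∷_)
open import Data.List.Relation.Unary.AllPairs using (_∷_)
open import Data.List.Relation.Unary.Linked as Linked using (Linked; [-]; _∷_)
open import Data.List.Relation.Unary.Unique.Propositional using (Unique)
import Data.List.Relation.Unary.Unique.Propositional.Properties as Uniqueₚ
open import Data.Maybe.Relation.Binary.Connected using (just)
open import Data.Product using (_×_; _,_; proj₂; ∃₂)
open import Data.Sum using (_⊎_; inj₁; inj₂; [_,_])
open import Function using (_∘_; flip; _⇔_; mk⇔; Equivalence; Injection)
open import Function.Properties.Inverse using (↔⇒↣)
open import Level using (Level)
open import Relation.Binary using (Rel; Transitive; Tri; tri<; tri≈; tri>)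
open import Relation.Binary.PropositionalEquality using (_≡_; _≢_; refl; sym; trans; subst₂)
open import Relation.Nullary using (¬_; yes; no; contradiction)
open import Relation.Nullary.Decidable using (_×-dec_)
open import Relation.Unary using (Pred; Decidable; _⊆_; _∪_; _⊥_)

private
  variable
    a p q r ℓ : Level
    A : Set a

module _ {P : Pred A p} {Q : Pred A q} {R : Pred A r}
         (P? : Decidable P) (Q? : Decidable Q) (R? : Decidable R) where

  length-filter-≤-+ : P ⊆ Q ∪ R → ∀ xs →
    length (filter P? xs) ≤ length (filter Q? xs) + length (filter R? xs)
  length-filter-≤-+ P⊆Q∪R [] = z≤n
  length-filter-≤-+ P⊆Q∪R (x ∷ xs)
    with ih ← length-filter-≤-+ P⊆Q∪R xs | P? x | Q? x | R? x
  ... | yes px | no ¬qx | no ¬rx = contradiction (P⊆Q∪R px) [ ¬qx , ¬rx ]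
  ... | yes _  | yes _  | no _   = s≤s ih
  ... | yes _  | yes _  | yes _  = s≤s (ℕₚ.≤-trans ih (ℕₚ.+-monoʳ-≤ _ (ℕₚ.n≤1+n _)))
  ... | yes _  | no _   | yes _  = ℕₚ.≤-trans (s≤s ih) (ℕₚ.≤-reflexive (sym (ℕₚ.+-suc _ _)))
  ... | no _   | no _   | no _   = ih
  ... | no _   | yes _  | no _   = ℕₚ.m≤n⇒m≤1+n ih
  ... | no _   | yes _  | yes _  = ℕₚ.≤-trans ih (ℕₚ.+-mono-≤ (ℕₚ.n≤1+n _) (ℕₚ.n≤1+n _))
  ... | no _   | no _   | yes _  = ℕₚ.≤-trans ih (ℕₚ.+-monoʳ-≤ _ (ℕₚ.n≤1+n _))

  length-filter-+-≤ : Q ⊆ P → R ⊆ P → Q ⊥ R → ∀ xs →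
    length (filter Q? xs) + length (filter R? xs) ≤ length (filter P? xs)
  length-filter-+-≤ Q⊆P R⊆P Q⊥R [] = z≤n
  length-filter-+-≤ Q⊆P R⊆P Q⊥R (x ∷ xs)
    with ih ← length-filter-+-≤ Q⊆P R⊆P Q⊥R xs | P? x | Q? x | R? x
  ... | _      | yes qx | yes rx = contradiction (qx , rx) Q⊥R
  ... | no ¬px | yes qx | no _   = contradiction (Q⊆P qx) ¬px
  ... | no ¬px | no _   | yes rx = contradiction (R⊆P rx) ¬px
  ... | no _   | no _   | no _   = ih
  ... | yes _  | no _   | no _   = ℕₚ.m≤n⇒m≤1+n ih
  ... | yes _  | yes _  | no _   = s≤s ih
  ... | yes _  | no _   | yes _  = ℕₚ.≤-trans (ℕₚ.≤-reflexive (ℕₚ.+-suc _ _)) (s≤s ih)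

distinct-∈⇒2≤length : ∀ {x y : A} {xs} → x ∈ xs → y ∈ xs → x ≢ y → 2 ≤ length xs
distinct-∈⇒2≤length (here refl) (here refl) x≢y = contradiction refl x≢y
distinct-∈⇒2≤length (here _) (there (here _)) _ = s≤s (s≤s z≤n)
distinct-∈⇒2≤length (here _) (there (there _)) _ = s≤s (s≤s z≤n)
distinct-∈⇒2≤length (there (here _)) (here _) _ = s≤s (s≤s z≤n)
distinct-∈⇒2≤length (there (there _)) (here _) _ = s≤s (s≤s z≤n)
distinct-∈⇒2≤length (there x∈) (there y∈) x≢y = ℕₚ.m≤n⇒m≤1+n (distinct-∈⇒2≤length x∈ y∈ x≢y)

2≤length⇒distinct-∈ : ∀ {xs : List A} → Unique xs → 2 ≤ length xs →
  ∃₂ λ x y → x ∈ xs × y ∈ xs × x ≢ y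
2≤length⇒distinct-∈ {xs = x ∷ y ∷ _} ((x≢y ∷ _) ∷ _) _ = x , y , here refl , there (here refl) , x≢y
2≤length⇒distinct-∈ {xs = _ ∷ []} _ (s≤s ())

lookup-Linked : {R : Rel A ℓ} → Transitive R → ∀ {xs} → Linked R xs →
  ∀ {s t} → s < t → R (lookup xs s) (lookup xs t)
lookup-Linked R-trans (xRy ∷ ys) {Fin.zero} {Fin.suc t} _ = Linked.lookup R-trans ys (just xRy) t
lookup-Linked R-trans (_ ∷ ys) {Fin.suc s} {Fin.suc t} (s<s s<t) = lookup-Linked R-trans ys s<t

StrictlyIncreasing : ∀ {m n} → (Fin m → Fin n) → Set
StrictlyIncreasing f = ∀ s t → s < t → f s < f t

increasing₄ : ∀ {n} {a b c d : Fin n} → a < b → b < c → c < d →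
  StrictlyIncreasing (lookup (a ∷ b ∷ c ∷ d ∷ []))
increasing₄ a<b b<c c<d _ _ = lookup-Linked {R = _<_} Finₚ.<-trans (a<b ∷ b<c ∷ c<d ∷ [-])

StrictlyIncreasing⇒<-reflecting : ∀ {m n} {f : Fin m → Fin n} → StrictlyIncreasing f →
  ∀ {s t} → f s < f t → s < t
StrictlyIncreasing⇒<-reflecting f↑ {s} {t} fs<ft with Finₚ.<-cmp s t
... | tri< s<t _ _ = s<t
... | tri≈ _ refl _ = contradiction fs<ft (Finₚ.<-irrefl refl)
... | tri> _ _ t<s = contradiction (f↑ _ _ t<s) (Finₚ.<-asym fs<ft)

module _ {n : ℕ} (ω : Permutation′ n) where

  W : Fin n → Fin n
  W t = ω ⟨$⟩ʳ t

  W-injective : ∀ {s t} → W s ≡ W t → s ≡ t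
  W-injective = Injection.injective (↔⇒↣ ω)

  -- u lists the values of the occurrence in increasing order.
  containsPattern : (π : Fin 4 → Fin 4) (ι u : Fin 4 → Fin n) →
    StrictlyIncreasing ι → StrictlyIncreasing u → (∀ s → u (π s) ≡ W (ι s)) →
    ContainsPattern ω π
  containsPattern π ι u ι↑ u↑ uπ≡Wι = ι , ι↑ , λ s t →
      (StrictlyIncreasing⇒<-reflecting u↑ ∘ subst₂ _<_ (sym (uπ≡Wι s)) (sym (uπ≡Wι t)))
    , (subst₂ _<_ (uπ≡Wι s) (uπ≡Wι t) ∘ u↑ _ _)

  Below : Fin n → Pred (Fin n) _
  Below i t = i < t × W t < W i

  below? : ∀ i → Decidable (Below i)
  below? i t = (i <? t) ×-dec (W t <? W i)

  Between : Fin n → Fin n → Pred (Fin n) _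
  Between i j t = i < t × t < j × W t < W i

  between? : ∀ i j → Decidable (Between i j)
  between? i j t = (i <? t) ×-dec ((t <? j) ×-dec (W t <? W i))

  BelowAfter : Fin n → Fin n → Pred (Fin n) _
  BelowAfter i j t = j < t × W t < W i

  belowAfter? : ∀ i j → Decidable (BelowAfter i j)
  belowAfter? i j t = (j <? t) ×-dec (W t <? W i)

  #belowAfter : Fin n → Fin n → ℕ
  #belowAfter i j = length (filter (belowAfter? i j) (allFin n))

  cₚ₂-subadditive : ∀ {i j t} → W i < W j → cₚ₂ ω i t ≤ cₚ₂ ω i j + cₚ₂ ω j t
  cₚ₂-subadditive {i} {j} {t} Wi<Wj =
    length-filter-≤-+ (between? i t) (between? i j) (between? j t) split (allFin n)
    where
    split : Between i t ⊆ Between i j ∪ Between j t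
    split {k} (i<k , k<t , Wk<Wi) with Finₚ.<-cmp k j
    ... | tri< k<j _ _ = inj₁ (i<k , k<j , Wk<Wi)
    ... | tri≈ _ refl _ = contradiction Wk<Wi (Finₚ.<-asym Wi<Wj)
    ... | tri> _ _ j<k = inj₂ (j<k , k<t , Finₚ.<-trans Wk<Wi Wi<Wj)

  cₚ≡cₚ₂+#belowAfter : ∀ {i j} → i < j → W i < W j → cₚ ω i ≡ cₚ₂ ω i j + #belowAfter i j
  cₚ≡cₚ₂+#belowAfter {i} {j} i<j Wi<Wj = ℕₚ.≤-antisym
    (length-filter-≤-+ (below? i) (between? i j) (belowAfter? i j) split (allFin n))
    (length-filter-+-≤ (below? i) (between? i j) (belowAfter? i j)
      (λ (i<t , _ , Wt<Wi) → i<t , Wt<Wi)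
      (λ (j<t , Wt<Wi) → Finₚ.<-trans i<j j<t , Wt<Wi)
      (λ ((_ , t<j , _) , (j<t , _)) → Finₚ.<-asym t<j j<t)
      (allFin n))
    where
    split : Below i ⊆ Between i j ∪ BelowAfter i j
    split {t} (i<t , Wt<Wi) with Finₚ.<-cmp t j
    ... | tri< t<j _ _ = inj₁ (i<t , t<j , Wt<Wi)
    ... | tri≈ _ refl _ = contradiction Wt<Wi (Finₚ.<-asym Wi<Wj)
    ... | tri> _ _ j<t = inj₂ (j<t , Wt<Wi)

  mvec-before : ∀ {i j} x → j < i → mvec ω i x j ≡ 0
  mvec-before {i} {j} x j<i with j <? i
  ... | yes _ = refl
  ... | no j≮i = contradiction j<i j≮i

  mvec-diagonal : ∀ i x → mvec ω i x i ≡ x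
  mvec-diagonal i x with i <? i
  ... | yes i<i = contradiction i<i (Finₚ.<-irrefl refl)
  ... | no _ with i <? i
  ...   | yes i<i = contradiction i<i (Finₚ.<-irrefl refl)
  ...   | no _ = refl

  mvec-inversion : ∀ {i j} x → i < j → W j < W i → mvec ω i x j ≡ 0
  mvec-inversion {i} {j} x i<j Wj<Wi with j <? i
  ... | yes j<i = contradiction j<i (Finₚ.<-asym i<j)
  ... | no _ with i <? j
  ...   | no i≮j = contradiction i<j i≮j
  ...   | yes _ with W j <? W i
  ...     | yes _ = refl
  ...     | no Wj≮Wi = contradiction Wj<Wi Wj≮Wi

  mvec-nonInversion : ∀ {i j} x → i < j → ¬ W j < W i → mvec ω i x j ≡ x ∸ cₚ₂ ω i j
  mvec-nonInversion {i} {j} x i<j Wj≮Wi with j <? i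
  ... | yes j<i = contradiction j<i (Finₚ.<-asym i<j)
  ... | no _ with i <? j
  ...   | no i≮j = contradiction i<j i≮j
  ...   | yes _ with W j <? W i
  ...     | yes Wj<Wi = contradiction Wj<Wi Wj≮Wi
  ...     | no _ = refl

  mvec-≼⇔ : ∀ {i j x y} → i < j → 1 ≤ y →
    mvec ω j y ≼ mvec ω i x ⇔ (W i < W j × y + cₚ₂ ω i j ≤ x)
  mvec-≼⇔ {i} {j} {x} {y} i<j 1≤y = mk⇔ necessary sufficient
    where
    necessary : mvec ω j y ≼ mvec ω i x → W i < W j × y + cₚ₂ ω i j ≤ x
    necessary mj≼mi with mj≼mi j | W j <? W i
    ... | y≤mᵢⱼ | yes Wj<Wi
      rewrite mvec-diagonal j y | mvec-inversion x i<j Wj<Wi =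
        contradiction (ℕₚ.≤-trans 1≤y y≤mᵢⱼ) λ ()
    ... | y≤mᵢⱼ | no Wj≮Wi
      rewrite mvec-diagonal j y | mvec-nonInversion x i<j Wj≮Wi = Wi<Wj , y+e≤x
      where
      Wi<Wj : W i < W j
      Wi<Wj with Finₚ.<-cmp (W i) (W j)
      ... | tri< Wi<Wj _ _ = Wi<Wj
      ... | tri≈ _ Wi≡Wj _ = contradiction (W-injective Wi≡Wj) (Finₚ.<⇒≢ i<j)
      ... | tri> _ _ Wj<Wi = contradiction Wj<Wi Wj≮Wi
      e≤x : cₚ₂ ω i j ≤ x
      e≤x = ℕₚ.<⇒≤ (ℕₚ.m∸n≢0⇒n<m (ℕₚ.n>0⇒n≢0 (ℕₚ.≤-trans 1≤y y≤mᵢⱼ)))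
      y+e≤x : y + cₚ₂ ω i j ≤ x
      y+e≤x = ℕₚ.m≤o∸n⇒m+n≤o y e≤x y≤mᵢⱼ

    sufficient : W i < W j × y + cₚ₂ ω i j ≤ x → mvec ω j y ≼ mvec ω i x
    sufficient (Wi<Wj , y+e≤x) t with Finₚ.<-cmp t j
    ... | tri< t<j _ _ rewrite mvec-before y t<j = z≤n
    ... | tri≈ _ refl _ rewrite mvec-diagonal t y | mvec-nonInversion x i<j (Finₚ.<-asym Wi<Wj) =
      ℕₚ.m+n≤o⇒m≤o∸n y y+e≤x
    ... | tri> _ _ j<t with W t <? W j
    ...   | yes Wt<Wj rewrite mvec-inversion y j<t Wt<Wj = z≤n
    ...   | no Wt≮Wj rewrite mvec-nonInversion y j<t Wt≮Wj
                          | mvec-nonInversion x (Finₚ.<-trans i<j j<t) (Wt≮Wj ∘ flip Finₚ.<-trans Wi<Wj) =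
      begin
        y ∸ cₚ₂ ω j t                   ≤⟨ ℕₚ.∸-monoˡ-≤ (cₚ₂ ω j t) (ℕₚ.m+n≤o⇒m≤o∸n y y+e≤x) ⟩
        x ∸ cₚ₂ ω i j ∸ cₚ₂ ω j t       ≡⟨ ℕₚ.∸-+-assoc x (cₚ₂ ω i j) (cₚ₂ ω j t) ⟩
        x ∸ (cₚ₂ ω i j + cₚ₂ ω j t)     ≤⟨ ℕₚ.∸-monoʳ-≤ x (cₚ₂-subadditive Wi<Wj) ⟩
        x ∸ cₚ₂ ω i t                   ∎
      where open ℕₚ.≤-Reasoning

  mvec-⋠ : ∀ {i j x y} → i < j → 1 ≤ x → ¬ mvec ω i x ≼ mvec ω j y
  mvec-⋠ {i} {j} {x} {y} i<j 1≤x mi≼mj with mi≼mj i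
  ... | x≤0 rewrite mvec-diagonal i x | mvec-before y i<j =
    contradiction (ℕₚ.≤-trans 1≤x x≤0) λ ()

  mvec-≻ : ∀ {i j x y} → i < j → 1 ≤ x → mvec ω j y ≼ mvec ω i x → mvec ω i x ≻ mvec ω j y
  mvec-≻ i<j 1≤x mj≼mi = mj≼mi , λ mi≡mj → mvec-⋠ i<j 1≤x (ℕₚ.≤-reflexive ∘ mi≡mj)

  -- An occurrence of 3412 (ω(k) < ω(l)) or of 3421 (ω(l) < ω(k)).
  record Occurrence34 : Set where
    field
      i j k l     : Fin n
      i<j         : i < j
      j<k         : j < k
      k<l         : k < l
      Wi<Wj       : W i < W j
      Wk<Wi       : W k < W i
      Wl<Wi       : W l < W i

  2≤#belowAfter⇒Occurrence34 : ∀ {i j} → i < j → W i < W j → 2 ≤ #belowAfter i j → Occurrence34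
  2≤#belowAfter⇒Occurrence34 {i} {j} i<j Wi<Wj 2≤#
    with k , l , k∈ , l∈ , k≢l ←
      2≤length⇒distinct-∈ (Uniqueₚ.filter⁺ (belowAfter? i j) (Uniqueₚ.allFin⁺ n)) 2≤#
    with (j<k , Wk<Wi) ← proj₂ (∈-filter⁻ (belowAfter? i j) {xs = allFin n} k∈)
       | (j<l , Wl<Wi) ← proj₂ (∈-filter⁻ (belowAfter? i j) {xs = allFin n} l∈)
    with Finₚ.<-cmp k l
  ... | tri< k<l _ _ = record
    { i<j = i<j ; j<k = j<k ; k<l = k<l ; Wi<Wj = Wi<Wj ; Wk<Wi = Wk<Wi ; Wl<Wi = Wl<Wi }
  ... | tri≈ _ k≡l _ = contradiction k≡l k≢l
  ... | tri> _ _ l<k = record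
    { i<j = i<j ; j<k = j<l ; k<l = l<k ; Wi<Wj = Wi<Wj ; Wk<Wi = Wl<Wi ; Wl<Wi = Wk<Wi }

  parallelogram⇒Occurrence34 : HasParallelogramPattern ω → Occurrence34
  parallelogram⇒Occurrence34
    (i , j , a , _ , c , d , i<j , (_ , a≤cᵢ) , _ , _ , (1≤c , _) , _ , c<d , _ , (mⱼd≼mᵢa , _) , _)
    with (Wi<Wj , d+e≤a) ← Equivalence.to (mvec-≼⇔ i<j (ℕₚ.<⇒≤ (ℕₚ.≤-<-trans 1≤c c<d))) mⱼd≼mᵢa
    = 2≤#belowAfter⇒Occurrence34 i<j Wi<Wj (ℕₚ.+-cancelˡ-≤ e 2 _ (begin
        e + 2               ≤⟨ ℕₚ.+-monoʳ-≤ e (ℕₚ.≤-trans (s≤s 1≤c) c<d) ⟩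
        e + d               ≡⟨ ℕₚ.+-comm e d ⟩
        d + e               ≤⟨ ℕₚ.≤-trans d+e≤a a≤cᵢ ⟩
        cₚ ω i              ≡⟨ cₚ≡cₚ₂+#belowAfter i<j Wi<Wj ⟩
        e + #belowAfter i j ∎))
    where
    e = cₚ₂ ω i j
    open ℕₚ.≤-Reasoning

  Occurrence34⇒parallelogram : Occurrence34 → HasParallelogramPattern ω
  Occurrence34⇒parallelogram o =
    i , j , e + 2 , e + 1 , 1 , 2 , i<j ,
    (1≤e+ 1 , e+2≤cᵢ) , (1≤e+ 0 , ℕₚ.≤-trans (ℕₚ.+-monoʳ-≤ e (ℕₚ.n≤1+n 1)) e+2≤cᵢ) ,
    ℕₚ.≤-reflexive (sym (ℕₚ.+-suc e 1)) ,
    (s≤s z≤n , ℕₚ.≤-trans (ℕₚ.n≤1+n 1) 2≤cⱼ) , (s≤s z≤n , 2≤cⱼ) , s<s z<s ,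
    trans (ℕₚ.+-assoc e 2 1) (sym (ℕₚ.+-assoc e 1 2)) ,
    shifted-≻ (s≤s z≤n) , shifted-≻ (s≤s z≤n) ,
    (mvec-⋠ i<j (1≤e+ 0) , mⱼ₂⋠mᵢₑ₊₁)
    where
    open Occurrence34 o
    e = cₚ₂ ω i j
    j<l = Finₚ.<-trans j<k k<l
    k≢l = Finₚ.<⇒≢ k<l

    1≤e+ : ∀ m → 1 ≤ e + suc m
    1≤e+ m = ℕₚ.≤-trans (s≤s z≤n) (ℕₚ.m≤n+m (suc m) e)

    e+2≤cᵢ : e + 2 ≤ cₚ ω i
    e+2≤cᵢ = ℕₚ.≤-trans
      (ℕₚ.+-monoʳ-≤ e (distinct-∈⇒2≤length
        (∈-filter⁺ (belowAfter? i j) (∈-allFin k) (j<k , Wk<Wi))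
        (∈-filter⁺ (belowAfter? i j) (∈-allFin l) (j<l , Wl<Wi)) k≢l))
      (ℕₚ.≤-reflexive (sym (cₚ≡cₚ₂+#belowAfter i<j Wi<Wj)))

    2≤cⱼ : 2 ≤ cₚ ω j
    2≤cⱼ = distinct-∈⇒2≤length
      (∈-filter⁺ (below? j) (∈-allFin k) (j<k , Finₚ.<-trans Wk<Wi Wi<Wj))
      (∈-filter⁺ (below? j) (∈-allFin l) (j<l , Finₚ.<-trans Wl<Wi Wi<Wj)) k≢l

    shifted-≻ : ∀ {y} → 1 ≤ y → mvec ω i (e + y) ≻ mvec ω j y
    shifted-≻ {y} 1≤y = mvec-≻ i<j (ℕₚ.≤-trans 1≤y (ℕₚ.m≤n+m y e))
      (Equivalence.from (mvec-≼⇔ i<j 1≤y) (Wi<Wj , ℕₚ.≤-reflexive (ℕₚ.+-comm y e)))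

    mⱼ₂⋠mᵢₑ₊₁ : ¬ mvec ω j 2 ≼ mvec ω i (e + 1)
    mⱼ₂⋠mᵢₑ₊₁ mⱼ₂≼mᵢₑ₊₁ with proj₂ (Equivalence.to (mvec-≼⇔ i<j (s≤s z≤n)) mⱼ₂≼mᵢₑ₊₁)
    ... | 2+e≤e+1 = ℕₚ.<-irrefl refl (ℕₚ.≤-trans (s≤s (ℕₚ.≤-reflexive (ℕₚ.+-comm e 1))) 2+e≤e+1)

  Occurrence34⇒3412⊎3421 : Occurrence34 → ContainsPattern ω p3412 ⊎ ContainsPattern ω p3421
  Occurrence34⇒3412⊎3421 o = byValues (Finₚ.<-cmp (W k) (W l))
    where
    open Occurrence34 o
    ι = lookup (i ∷ j ∷ k ∷ l ∷ [])
    ι↑ = increasing₄ i<j j<k k<l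

    byValues : Tri (W k < W l) (W k ≡ W l) (W l < W k) →
      ContainsPattern ω p3412 ⊎ ContainsPattern ω p3421
    byValues (tri< Wk<Wl _ _) = inj₁ (containsPattern p3412 ι
      (lookup (W k ∷ W l ∷ W i ∷ W j ∷ []))
      ι↑ (increasing₄ Wk<Wl Wl<Wi Wi<Wj) λ { 0F → refl ; 1F → refl ; 2F → refl ; 3F → refl })
    byValues (tri≈ _ Wk≡Wl _) = contradiction (W-injective Wk≡Wl) (Finₚ.<⇒≢ k<l)
    byValues (tri> _ _ Wl<Wk) = inj₂ (containsPattern p3421 ι
      (lookup (W l ∷ W k ∷ W i ∷ W j ∷ []))
      ι↑ (increasing₄ Wl<Wk Wk<Wi Wi<Wj) λ { 0F → refl ; 1F → refl ; 2F → refl ; 3F → refl })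

  ContainsPattern⇒Occurrence34 : ∀ {π} → ContainsPattern ω π →
    π 0F < π 1F → π 2F < π 0F → π 3F < π 0F → Occurrence34
  ContainsPattern⇒Occurrence34 (ι , ι↑ , order) π₀<π₁ π₂<π₀ π₃<π₀ = record
    { i<j = ι↑ 0F 1F z<s ; j<k = ι↑ 1F 2F (s<s z<s) ; k<l = ι↑ 2F 3F (s<s (s<s z<s))
    ; Wi<Wj = proj₂ (order 0F 1F) π₀<π₁
    ; Wk<Wi = proj₂ (order 2F 0F) π₂<π₀
    ; Wl<Wi = proj₂ (order 3F 0F) π₃<π₀
    }

  3412⊎3421⇒Occurrence34 : ContainsPattern ω p3412 ⊎ ContainsPattern ω p3421 → Occurrence34
  3412⊎3421⇒Occurrence34 = [ (λ occ → ContainsPattern⇒Occurrence34 occ (s<s (s<s z<s)) z<s (s<s z<s))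
                            , (λ occ → ContainsPattern⇒Occurrence34 occ (s<s (s<s z<s)) (s<s z<s) z<s)
                            ]

mainTheorem8 : (n : ℕ) (ω : Permutation′ n) →
    HasParallelogramPattern ω ⇔ (ContainsPattern ω p3412 ⊎ ContainsPattern ω p3421)
mainTheorem8 n ω = mk⇔
  (Occurrence34⇒3412⊎3421 ω ∘ parallelogram⇒Occurrence34 ω)
  (Occurrence34⇒parallelogram ω ∘ 3412⊎3421⇒Occurrence34 ω)
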